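{- Let $n\ge 1$, let $f:\mathbb{B}^n\to\mathbb{B}^n$ be a Boolean network with $\mathbb{B}=\{0,1\}$, let $M\in\mathbb{M}$ be a marker and let $k\in\{0,\ldots,n\}$. For a perturbation $P\in\mathbb{M}^{\leq k}$, say that $P$ satisfies $\phi$ if for every configuration $x\in\mathbb{B}^n$ with $x\not\models M$ there exists $y\in c(TS_{f/P}(x))$ with $TS_{f/P}(y)\neq TS_{f/P}(x)$. Let $\phi_u$ be any property of perturbations in $\mathbb{M}^{\leq k}$ such that every $P\in\mathbb{M}^{\leq k}$ satisfying $\phi$ also satisfies $\phi_u$ (i.e. $\phi_u\Leftarrow\phi$; for instance $\phi_u$ is "$P\in\mathbb{M}^{\leq k}$"). Let $\bar P\in\mathbb{M}^{\leq k}$ satisfy $\phi_u$, and let $\bar x\in\mathbb{B}^n$ be a counter-example for $\bar P$, that is, $\bar x\not\models M$ and for every $y\in c(TS_{f/\bar P}(\bar x))$ one has $TS_{f/\bar P}(y)=TS_{f/\bar P}(\bar x)$. For $P\in\mathbb{M}^{\leq k}$ define $\phi_r(\bar x)$ to hold for $P$ iff there exists $y\in\mathbb{B}^n$ with $c(TS_{f/P}(y))\subsetneq c(TS_{f/P}(\bar x))$ and $TS_{f/P}(y)\models M$. Then every $P\in\mathbb{M}^{\leq k}$ satisfying $\phi$ satisfies both $\phi_u$ and $\phi_r(\bar x)$, i.e. $\phi_u\wedge\phi_r(\bar x)\Leftarrow\phi$.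
   Context: A Boolean network (BN) of dimension $n$ is a map $f:\mathbb{B}^n\to\mathbb{B}^n$; $f_i$ denotes its $i$-th component. A subcube is a vector $h\in\{0,1,\ast\}^n$, with vertex set $c(h)=\{x\in\mathbb{B}^n\mid h_i\neq\ast\Rightarrow x_i=h_i\}$. A subcube $h$ is a trap space of $f$ if $f(x)\in c(h)$ for all $x\in c(h)$; it is minimal if no trap space $h'$ has $c(h')\subsetneq c(h)$. For $x\in\mathbb{B}^n$, $TS_f(x)$ denotes the smallest trap space of $f$ containing $x$ (it exists and is unique since intersections of trap spaces are trap spaces). $\mathbb{M}$ is the set of partial maps from $\{1,\ldots,n\}$ to $\mathbb{B}$, and $\mathbb{M}^{\leq k}$ those with at most $k$ associations; such maps serve as markers and perturbations. A configuration $x$ matches $M$, written $x\models M$, if $x_i=b$ for every $i\mapsto b\in M$; a subcube $h$ matches $M$, $h\models M$, if $h_i=b$ for every $i\mapsto b\in M$ (equivalently all $x\in c(h)$ match $M$). For a perturbation $P\in\mathbb{M}$, the perturbed BN $f/P$ is defined by $(f/P)_i(x)=b$ if $i\mapsto b\in P$ and $(f/P)_i(x)=f_i(x)$ otherwise. A perturbation satisfies $\phi$ exactly when all minimal trap spaces of $f/P$ match $M$. -}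

module Defs where

open import Data.Nat using (ℕ; zero; suc; _+_)
open import Data.Bool using (Bool; true; false; _∧_; if_then_else_)
open import Data.Maybe using (Maybe; just; nothing)
open import Data.Fin using (Fin)
open import Data.Vec using (Vec; []; _∷_; lookup; tabulate; zipWith; replicate)
open import Data.List using (List; []; _∷_; map; concatMap; filter; foldr)
open import Data.Product using (Σ; _×_; ∃; _,_)
open import Relation.Binary.PropositionalEquality using (_≡_)
open import Relation.Nullary using (¬_; Dec; yes; no)
import Data.Bool.Properties as BP

Config : ℕ → Set
Config n = Vec Bool n

BN : ℕ → Set
BN n = Config n → Config n

-- Subcubes h ∈ {0,1,∗}ⁿ ; nothing plays the role of ∗
Subcube : ℕ → Set
Subcube n = Vec (Maybe Bool) n

-- Partial maps {1..n} ⇀ 𝔹 (markers / perturbations); nothing = unassigned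
PMap : ℕ → Set
PMap n = Vec (Maybe Bool) n

size : ∀ {n} → PMap n → ℕ
size [] = 0
size (just _ ∷ m) = suc (size m)
size (nothing ∷ m) = size m

_∈c_ : ∀ {n} → Config n → Subcube n → Set
x ∈c h = ∀ i b → lookup h i ≡ just b → lookup x i ≡ b

_⊆c_ : ∀ {n} → Subcube n → Subcube n → Set
h' ⊆c h = ∀ x → x ∈c h' → x ∈c h

_⊊c_ : ∀ {n} → Subcube n → Subcube n → Set
h' ⊊c h = h' ⊆c h × ∃ λ x → x ∈c h × ¬ (x ∈c h')

_⊨_ : ∀ {n} → Config n → PMap n → Set
x ⊨ M = ∀ i b → lookup M i ≡ just b → lookup x i ≡ b

_⊨ₕ_ : ∀ {n} → Subcube n → PMap n → Set
h ⊨ₕ M = ∀ i b → lookup M i ≡ just b → lookup h i ≡ just b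

_/ₚ_ : ∀ {n} → BN n → PMap n → BN n
(f /ₚ P) x = tabulate λ i → pick (lookup P i) (lookup (f x) i)
  where
  pick : Maybe Bool → Bool → Bool
  pick (just b) _ = b
  pick nothing  c = c

-- Smallest trap space TS_f(x), computed literally as the intersection of
-- all trap spaces of f containing x (a finite enumeration).

allConfigs : ∀ n → List (Config n)
allConfigs zero = [] ∷ []
allConfigs (suc n) = concatMap (λ v → (true ∷ v) ∷ (false ∷ v) ∷ []) (allConfigs n)

allSubcubes : ∀ n → List (Subcube n)
allSubcubes zero = [] ∷ []
allSubcubes (suc n) =
  concatMap (λ v → (just true ∷ v) ∷ (just false ∷ v) ∷ (nothing ∷ v) ∷ []) (allSubcubes n)

memᵇ : ∀ {n} → Config n → Subcube n → Bool
memᵇ [] [] = true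
memᵇ (a ∷ x) (nothing ∷ h) = memᵇ x h
memᵇ (a ∷ x) (just b ∷ h) = (if a then b else not′ b) ∧ memᵇ x h
  where
  not′ : Bool → Bool
  not′ true = false
  not′ false = true

isTrapᵇ : ∀ {n} → BN n → Subcube n → Bool
isTrapᵇ {n} f h = foldr (λ x r → (if memᵇ x h then memᵇ (f x) h else true) ∧ r) true (allConfigs n)

-- componentwise intersection of two subcubes (both containing a common point)
_⊓_ : ∀ {n} → Subcube n → Subcube n → Subcube n
_⊓_ = zipWith meet
  where
  meet : Maybe Bool → Maybe Bool → Maybe Bool
  meet (just b) _ = just b
  meet nothing c = c

TS : ∀ {n} → BN n → Config n → Subcube n
TS {n} f x =
  foldr _⊓_ (replicate n nothing)
    (filter (λ h → BP.T? (isTrapᵇ f h ∧ memᵇ x h)) (allSubcubes n))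

Phi : ∀ {n} → BN n → PMap n → PMap n → Set
Phi f M P = ∀ x → ¬ (x ⊨ M) →
  ∃ λ y → y ∈c TS (f /ₚ P) x × ¬ (TS (f /ₚ P) y ≡ TS (f /ₚ P) x)

CounterExample : ∀ {n} → BN n → PMap n → PMap n → Config n → Set
CounterExample f M P x = ¬ (x ⊨ M) ×
  (∀ y → y ∈c TS (f /ₚ P) x → TS (f /ₚ P) y ≡ TS (f /ₚ P) x)

PhiR : ∀ {n} → BN n → PMap n → Config n → PMap n → Set
PhiR f M x P = ∃ λ y → (TS (f /ₚ P) y ⊊c TS (f /ₚ P) x) × (TS (f /ₚ P) y ⊨ₕ M)

{-# OPTIONS --safe #-}
-- Under φ every configuration outside M escapes to a strictly smaller trap
-- space: a trap space h ⊭ M contains a point w ⊭ M (flip a free coordinate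
-- if needed), and φ at w yields y with TS(y) ⊊ TS(w) ⊆ h.  Smaller trap
-- spaces have fewer free coordinates, so iterating from x̄ must end in a
-- trap space matching M, strictly inside TS(x̄).
module Submission where

open import Defs
open import Data.Nat using (ℕ; zero; suc; _≤_; _<_; z≤n; s≤s)
open import Data.Nat.Properties using (m≤n⇒m≤1+n)
open import Data.Nat.Induction using (<-wellFounded)
open import Data.Bool using (Bool; true; false; T; not; _∧_)
open import Data.Bool.Properties using (T?; T-∧; not-¬)
import Data.Bool as Bool
open import Data.Maybe using (just; nothing)
open import Data.Maybe.Properties using (≡-dec)
open import Data.Fin using (Fin; zero; suc)
open import Data.Fin.Properties using (all?; ¬∀⟶∃¬)
import Data.Fin.Properties as Fin
open import Data.Vec using ([]; _∷_; lookup; replicate; _[_]≔_)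
open import Data.Vec.Properties using (lookup-replicate; lookup∘update; lookup∘update′)
open import Data.List using (List; []; _∷_; foldr; filter)
open import Data.List.Membership.Propositional using (_∈_)
open import Data.List.Membership.Propositional.Properties using (∈-filter⁺; ∈-filter⁻)
open import Data.List.Relation.Unary.Any using (here; there)
open import Data.Product using (_×_; _,_; proj₁; proj₂; ∃; ∃₂)
open import Data.Sum using (_⊎_; inj₁; inj₂)
open import Data.Empty using (⊥-elim)
open import Function using (_∘_; Equivalence)
open import Induction.WellFounded using (WellFounded; Acc; acc; module Subrelation)
import Relation.Binary.Construct.On as On
open import Relation.Binary.PropositionalEquality using (_≡_; _≢_; refl; sym; trans; cong)
open import Relation.Nullary using (¬_; Dec; yes; no)
open import Relation.Nullary.Decidable using (map′)

private
  variable
    n : ℕ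
    b : Bool
    h h' h'' : Subcube n

-- A record, not a function type, so that h' and h can be inferred from proofs.
record _≼_ (h' h : Subcube n) : Set where
  constructor refines
  field fixed : ∀ i {b} → lookup h i ≡ just b → lookup h' i ≡ just b
open _≼_

_≺_ : Subcube n → Subcube n → Set
h' ≺ h = h' ≼ h × ∃₂ λ i b → lookup h i ≡ nothing × lookup h' i ≡ just b

≼-trans : h ≼ h' → h' ≼ h'' → h ≼ h''
≼-trans p q = refines λ i → fixed p i ∘ fixed q i

≼-tail : ∀ {a a'} → (a' ∷ h') ≼ (a ∷ h) → h' ≼ h
≼-tail p = refines λ i → fixed p (suc i)

≼⇒⊆c : h' ≼ h → h' ⊆c h
≼⇒⊆c p x x∈h' i b = x∈h' i b ∘ fixed p i

≺-trans : h ≺ h' → h' ≺ h'' → h ≺ h''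
≺-trans (p , _) (q , i , b , h''ᵢ , h'ᵢ) = ≼-trans p q , i , b , h''ᵢ , fixed p i h'ᵢ

≺-≼-trans : h ≺ h' → h' ≼ h'' → h ≺ h''
≺-≼-trans {h'' = h''} (p , i , b , h'ᵢ , hᵢ) q with lookup h'' i in h''ᵢ
... | nothing = ≼-trans p q , i , b , h''ᵢ , hᵢ
... | just c with trans (sym h'ᵢ) (fixed q i h''ᵢ)
...   | ()

≺-cons : ∀ {a a'} → (a' ∷ h') ≼ (a ∷ h) → h' ≺ h → (a' ∷ h') ≺ (a ∷ h)
≺-cons p (_ , i , b , hᵢ , h'ᵢ) = p , suc i , b , hᵢ , h'ᵢ

≼-≢⇒≺ : (h' h : Subcube n) → h' ≼ h → h' ≢ h → h' ≺ h
≼-≢⇒≺ [] [] _ h'≢h = ⊥-elim (h'≢h refl)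
≼-≢⇒≺ (just b ∷ h') (nothing ∷ h) p _ = p , zero , b , refl , refl
≼-≢⇒≺ (nothing ∷ h') (nothing ∷ h) p h'≢h =
  ≺-cons p (≼-≢⇒≺ h' h (≼-tail p) (h'≢h ∘ cong (nothing ∷_)))
≼-≢⇒≺ (a' ∷ h') (just c ∷ h) p h'≢h with fixed p zero refl
... | refl = ≺-cons p (≼-≢⇒≺ h' h (≼-tail p) (h'≢h ∘ cong (just c ∷_)))

dim : Subcube n → ℕ
dim [] = 0
dim (nothing ∷ h) = suc (dim h)
dim (just _ ∷ h) = dim h

≼⇒dim≤ : (h' h : Subcube n) → h' ≼ h → dim h' ≤ dim h
≼⇒dim≤ [] [] p = z≤n
≼⇒dim≤ (a' ∷ h') (just c ∷ h) p with fixed p zero refl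
... | refl = ≼⇒dim≤ h' h (≼-tail p)
≼⇒dim≤ (nothing ∷ h') (nothing ∷ h) p = s≤s (≼⇒dim≤ h' h (≼-tail p))
≼⇒dim≤ (just _ ∷ h') (nothing ∷ h) p = m≤n⇒m≤1+n (≼⇒dim≤ h' h (≼-tail p))

≺⇒dim< : (h' h : Subcube n) → h' ≺ h → dim h' < dim h
≺⇒dim< (just _ ∷ h') (nothing ∷ h) (p , zero , _) = s≤s (≼⇒dim≤ h' h (≼-tail p))
≺⇒dim< (a' ∷ h') (just c ∷ h) (p , suc i , b , hᵢ , h'ᵢ) with fixed p zero refl
... | refl = ≺⇒dim< h' h (≼-tail p , i , b , hᵢ , h'ᵢ)
≺⇒dim< (nothing ∷ h') (nothing ∷ h) (p , suc i , b , hᵢ , h'ᵢ) =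
  s≤s (≺⇒dim< h' h (≼-tail p , i , b , hᵢ , h'ᵢ))
≺⇒dim< (just _ ∷ h') (nothing ∷ h) (p , suc i , b , hᵢ , h'ᵢ) =
  m≤n⇒m≤1+n (≺⇒dim< h' h (≼-tail p , i , b , hᵢ , h'ᵢ))

≺-wellFounded : WellFounded (_≺_ {n})
≺-wellFounded = Subrelation.wellFounded (≺⇒dim< _ _) (On.wellFounded dim <-wellFounded)

[]≔-∈c : (x : Config n) (h : Subcube n) (i : Fin n) (v : Bool) →
         x ∈c h → lookup h i ≡ nothing → (x [ i ]≔ v) ∈c h
[]≔-∈c x h i v x∈h hᵢ j b hⱼ with i Fin.≟ j
... | yes refl with trans (sym hᵢ) hⱼ
...   | ()
[]≔-∈c x h i v x∈h hᵢ j b hⱼ | no i≢j =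
  trans (lookup∘update′ (i≢j ∘ sym) x v) (x∈h j b hⱼ)

[]≔-not-∉c : (x : Config n) (h : Subcube n) (i : Fin n) →
             lookup h i ≡ just b → ¬ (x [ i ]≔ not b) ∈c h
[]≔-not-∉c {b = b} x h i hᵢ x′∈h =
  not-¬ refl (sym (trans (sym (lookup∘update i x (not b))) (x′∈h i b hᵢ)))

≺⇒⊊c : (x : Config n) → x ∈c h → h' ≺ h → h' ⊊c h
≺⇒⊊c {h = h} {h' = h'} x x∈h (p , i , b , hᵢ , h'ᵢ) =
  ≼⇒⊆c p , x [ i ]≔ not b , []≔-∈c x h i (not b) x∈h hᵢ , []≔-not-∉c x h' i h'ᵢ

memᵇ-head : ∀ a c (x : Config n) (h : Subcube n) →
            T (memᵇ (a ∷ x) (just c ∷ h)) → a ≡ c × T (memᵇ x h)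
memᵇ-head true true x h t = refl , t
memᵇ-head false false x h t = refl , t

memᵇ⇒∈c : (x : Config n) (h : Subcube n) → T (memᵇ x h) → x ∈c h
memᵇ⇒∈c [] [] t ()
memᵇ⇒∈c (a ∷ x) (nothing ∷ h) t zero b ()
memᵇ⇒∈c (a ∷ x) (nothing ∷ h) t (suc i) = memᵇ⇒∈c x h t i
memᵇ⇒∈c (a ∷ x) (just c ∷ h) t zero b refl = proj₁ (memᵇ-head a c x h t)
memᵇ⇒∈c (a ∷ x) (just c ∷ h) t (suc i) = memᵇ⇒∈c x h (proj₂ (memᵇ-head a c x h t)) i

∈c⇒memᵇ : (x : Config n) (h : Subcube n) → x ∈c h → T (memᵇ x h)
∈c⇒memᵇ [] [] _ = _
∈c⇒memᵇ (a ∷ x) (nothing ∷ h) x∈h = ∈c⇒memᵇ x h (x∈h ∘ suc)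
∈c⇒memᵇ (a ∷ x) (just c ∷ h) x∈h with x∈h zero c refl
∈c⇒memᵇ (true ∷ x) (just true ∷ h) x∈h | refl = ∈c⇒memᵇ x h (x∈h ∘ suc)
∈c⇒memᵇ (false ∷ x) (just false ∷ h) x∈h | refl = ∈c⇒memᵇ x h (x∈h ∘ suc)

⊓-just : (h g : Subcube n) (i : Fin n) → lookup h i ≡ just b → lookup (h ⊓ g) i ≡ just b
⊓-just (just c ∷ h) (_ ∷ g) zero refl = refl
⊓-just (_ ∷ h) (_ ∷ g) (suc i) hᵢ = ⊓-just h g i hᵢ

⊓-nothing : (h g : Subcube n) (i : Fin n) →
            lookup h i ≡ nothing → lookup (h ⊓ g) i ≡ lookup g i
⊓-nothing (nothing ∷ h) (_ ∷ g) zero refl = refl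
⊓-nothing (_ ∷ h) (_ ∷ g) (suc i) hᵢ = ⊓-nothing h g i hᵢ

⊓-fixed : (h g : Subcube n) (i : Fin n) → lookup (h ⊓ g) i ≡ just b →
          lookup h i ≡ just b ⊎ lookup g i ≡ just b
⊓-fixed (just c ∷ h) (_ ∷ g) zero e = inj₁ e
⊓-fixed (nothing ∷ h) (_ ∷ g) zero e = inj₂ e
⊓-fixed (_ ∷ h) (_ ∷ g) (suc i) e = ⊓-fixed h g i e

⋂ : List (Subcube n) → Subcube n
⋂ {n} = foldr _⊓_ (replicate n nothing)

⋂-fixed : (L : List (Subcube n)) (i : Fin n) →
          lookup (⋂ L) i ≡ just b → ∃ λ h → h ∈ L × lookup h i ≡ just b
⋂-fixed {n} [] i e with trans (sym (lookup-replicate {n = n} i nothing)) e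
... | ()
⋂-fixed (h ∷ L) i e with ⊓-fixed h (⋂ L) i e
... | inj₁ hᵢ = h , here refl , hᵢ
... | inj₂ ⋂Lᵢ with ⋂-fixed L i ⋂Lᵢ
...   | h' , h'∈L , h'ᵢ = h' , there h'∈L , h'ᵢ

∈c-⋂ : (x : Config n) (L : List (Subcube n)) → (∀ {h} → h ∈ L → x ∈c h) → x ∈c ⋂ L
∈c-⋂ x L x∈L i b e with ⋂-fixed L i e
... | h , h∈L , hᵢ = x∈L h∈L i b hᵢ

⋂-≼ : (x : Config n) (L : List (Subcube n)) →
      (∀ {h} → h ∈ L → x ∈c h) → h ∈ L → ⋂ L ≼ h
⋂-≼ x (h' ∷ L) x∈L (here refl) = refines λ i → ⊓-just h' (⋂ L) i
⋂-≼ {h = h} x (h' ∷ L) x∈L (there h∈L) = refines fixedAt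
  where
  fixedAt : ∀ i {b} → lookup h i ≡ just b → lookup (h' ⊓ ⋂ L) i ≡ just b
  -- Where h' fixes i, it agrees with h because both contain x.
  fixedAt i hᵢ with lookup h' i in h'ᵢ
  ... | nothing = trans (⊓-nothing h' (⋂ L) i h'ᵢ)
                    (fixed (⋂-≼ x L (x∈L ∘ there) h∈L) i hᵢ)
  ... | just c = trans (⊓-just h' (⋂ L) i h'ᵢ)
                   (cong just (trans (sym (x∈L (here refl) i c h'ᵢ)) (x∈L (there h∈L) i _ hᵢ)))

module _ (g : BN n) where

  traps : Config n → List (Subcube n)
  traps x = filter (λ h → T? (isTrapᵇ g h ∧ memᵇ x h)) (allSubcubes n)

  ∈-traps⁻ : (x : Config n) → h ∈ traps x → h ∈ allSubcubes n × T (isTrapᵇ g h) × x ∈c h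
  ∈-traps⁻ {h = h} x h∈ with ∈-filter⁻ (λ h → T? (isTrapᵇ g h ∧ memᵇ x h)) h∈
  ... | h∈all , t with Equivalence.to T-∧ t
  ...   | trap , mem = h∈all , trap , memᵇ⇒∈c x h mem

  ∈-traps⁺ : (x : Config n) → h ∈ allSubcubes n → T (isTrapᵇ g h) → x ∈c h → h ∈ traps x
  ∈-traps⁺ {h = h} x h∈all trap x∈h =
    ∈-filter⁺ (λ h → T? (isTrapᵇ g h ∧ memᵇ x h)) h∈all
      (Equivalence.from T-∧ (trap , ∈c⇒memᵇ x h x∈h))

  traps-∋ : (x : Config n) → h ∈ traps x → x ∈c h
  traps-∋ x = proj₂ ∘ proj₂ ∘ ∈-traps⁻ x

  ∈c-TS : (x : Config n) → x ∈c TS g x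
  ∈c-TS x = ∈c-⋂ x (traps x) (traps-∋ x)

  -- A coordinate fixed in TS g x is fixed by some trap space h ∋ x, and y ∈ TS g x ⊆ h.
  TS-mono : (x y : Config n) → y ∈c TS g x → TS g y ≼ TS g x
  TS-mono x y y∈TSx = refines fixedAt
    where
    fixedAt : ∀ i {b} → lookup (TS g x) i ≡ just b → lookup (TS g y) i ≡ just b
    fixedAt i TSxᵢ with ⋂-fixed (traps x) i TSxᵢ
    ... | h , h∈ , hᵢ with ∈-traps⁻ x h∈
    ...   | h∈all , trap , _ =
      fixed (⋂-≼ y (traps y) (traps-∋ y) (∈-traps⁺ y h∈all trap y∈h)) i hᵢ
      where
      y∈h : y ∈c h
      y∈h = ≼⇒⊆c (⋂-≼ x (traps x) (traps-∋ x) h∈) y y∈TSx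

matchesAt? : (h : Subcube n) (M : PMap n) (i : Fin n) →
             Dec (∀ b → lookup M i ≡ just b → lookup h i ≡ just b)
matchesAt? h M i with lookup M i
... | nothing = yes λ _ ()
... | just b =
  map′ (λ { hᵢ _ refl → hᵢ }) (λ m → m b refl) (≡-dec Bool._≟_ (lookup h i) (just b))

_⊨ₕ?_ : (h : Subcube n) (M : PMap n) → Dec (h ⊨ₕ M)
h ⊨ₕ? M = all? (matchesAt? h M)

⊨ₕ⇒⊨ : (x : Config n) (h : Subcube n) (M : PMap n) → x ∈c h → h ⊨ₕ M → x ⊨ M
⊨ₕ⇒⊨ x h M x∈h h⊨M i b = x∈h i b ∘ h⊨M i b

¬⊨ₕ⇒∃¬⊨ : (x : Config n) (h : Subcube n) (M : PMap n) →
          x ∈c h → ¬ h ⊨ₕ M → ∃ λ w → w ∈c h × ¬ w ⊨ M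
¬⊨ₕ⇒∃¬⊨ x h M x∈h h⊭M with ¬∀⟶∃¬ _ _ (matchesAt? h M) h⊭M
... | i , hᵢ⊭Mᵢ with lookup M i in Mᵢ | lookup h i in hᵢ
...   | nothing | _ = ⊥-elim (hᵢ⊭Mᵢ λ _ ())
...   | just b | nothing =
  -- w ⊨ M unfolds to w ∈c M.
  x [ i ]≔ not b , []≔-∈c x h i (not b) x∈h hᵢ , []≔-not-∉c x M i Mᵢ
...   | just b | just c =
  x , x∈h , λ x⊨M →
    hᵢ⊭Mᵢ λ { _ refl → cong just (trans (sym (x∈h i c hᵢ)) (x⊨M i b Mᵢ)) }

module Descent (g : BN n) (M : PMap n)
  (φ : ∀ x → ¬ x ⊨ M → ∃ λ y → y ∈c TS g x × TS g y ≢ TS g x) where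

  escape : ∀ x → ¬ TS g x ⊨ₕ M → ∃ λ y → TS g y ≺ TS g x
  escape x TSx⊭M with ¬⊨ₕ⇒∃¬⊨ x (TS g x) M (∈c-TS g x) TSx⊭M
  ... | w , w∈TSx , w⊭M with φ w w⊭M
  ...   | y , y∈TSw , TSy≢TSw =
    y , ≺-≼-trans (≼-≢⇒≺ (TS g y) (TS g w) (TS-mono g w y y∈TSw) TSy≢TSw)
                  (TS-mono g x w w∈TSx)

  descend : ∀ x → Acc _≺_ (TS g x) → ¬ TS g x ⊨ₕ M →
            ∃ λ y → TS g y ≺ TS g x × TS g y ⊨ₕ M
  descend x (acc rs) TSx⊭M with escape x TSx⊭M
  ... | y , y≺x with TS g y ⊨ₕ? M
  ...   | yes TSy⊨M = y , y≺x , TSy⊨M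
  ...   | no TSy⊭M with descend y (rs y≺x) TSy⊭M
  ...     | z , z≺y , TSz⊨M = z , ≺-trans z≺y y≺x , TSz⊨M

  matching-below : ∀ x → ¬ x ⊨ M → ∃ λ y → TS g y ⊊c TS g x × TS g y ⊨ₕ M
  matching-below x x⊭M
    with descend x (≺-wellFounded _) (x⊭M ∘ ⊨ₕ⇒⊨ x (TS g x) M (∈c-TS g x))
  ... | y , y≺x , TSy⊨M = y , ≺⇒⊊c x (∈c-TS g x) y≺x , TSy⊨M

lemma1 : (n : ℕ) → 1 ≤ n → (f : BN n) → (M : PMap n) → (k : ℕ) → k ≤ n →
    (φu : PMap n → Set) →
    (∀ P → size P ≤ k → Phi f M P → φu P) →
    (P̄ : PMap n) → size P̄ ≤ k → φu P̄ →
    (x̄ : Config n) → CounterExample f M P̄ x̄ →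
    ∀ P → size P ≤ k → Phi f M P → φu P × PhiR f M x̄ P
lemma1 _ _ f M _ _ _ φ⇒φu _ _ _ x̄ (x̄⊭M , _) P |P|≤k φ =
  φ⇒φu P |P|≤k φ , matching-below x̄ x̄⊭M
  where open Descent (f /ₚ P) M φ
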